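{- Let $t$ be an odd integer. Suppose there exists a positive integer $b$ with $t \not\equiv \pm 1 \pmod{2^b}$, and let $b$ be the smallest such positive integer. Then for every integer $k \geq 0$ and every integer $i \geq 0$, the $2^k$ integers $$\frac{(t^2)^{i} - 1}{2^b}, \frac{(t^2)^{i+1} - 1}{2^b}, \ldots, \frac{(t^2)^{i+2^k-1} - 1}{2^b}$$ (i.e., any $2^k$ consecutive terms of the sequence $\left(\frac{(t^2)^n - 1}{2^b}\right)_{n \geq 0}$) are pairwise incongruent modulo $2^k$. -}

module Defs where

open import Data.Nat as ℕ using (ℕ)
open import Data.Nat.Properties using (m^n≢0)
open import Data.Integer using (ℤ; +_; _-_; _*_; _^_; _/ℕ_; 1ℤ)
open import Data.Integer.Divisibility using (_∣_)
open import Relation.Nullary using (¬_)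

Odd : ℤ → Set
Odd t = ¬ ((+ 2) ∣ t)

_≡_[mod_] : ℤ → ℤ → ℕ → Set
a ≡ c [mod m ] = (+ m) ∣ (a - c)

-- integer division by 2^b (exact in the use below)
_/2^_ : ℤ → ℕ → ℤ
x /2^ b = _/ℕ_ x (2 ℕ.^ b) {{m^n≢0 2 b}}

seqT : ℤ → ℕ → ℕ → ℤ
seqT t b n = (((t * t) ^ n) - 1ℤ) /2^ b

{-# OPTIONS --safe #-}
-- Write t² = 1 + 2^b v. Minimality of b forces b ≥ 3 and v odd: an odd t is ±1 modulo 4,
-- and if t ≡ ε (mod 2^(b-1)) but not modulo 2^b, then t - ε is 2^(b-1) times an odd
-- number while t + ε is twice an odd number. With S = t², the sequence is
-- seqT n = v (1 + S + ⋯ + S^(n-1)), so seqT (p + d) - seqT p = v S^p (1 + S + ⋯ + S^(d-1)).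
-- As S ≡ 1 (mod 4), the geometric sum of length d has the same parity as d, and doubling
-- its length multiplies it by 1 + S^d, which is twice an odd number. So it is divisible by
-- 2^k only when d is, which fails for 0 < d < 2^k.
module Submission where

open import Defs
open import Data.Nat using (ℕ; _+_; _^_; _≤_; _<_)
open import Data.Integer using (ℤ; 1ℤ; -1ℤ)
open import Data.Product using (_×_)
open import Data.Sum using (_⊎_)
open import Relation.Nullary using (¬_)
open import Relation.Binary.PropositionalEquality using (_≢_)

open import Data.Nat.Base using (zero; suc; _*_; _∸_; s≤s; z≤n; NonZero; >-nonZero; ≢-nonZero)
open import Data.Nat.Properties
  using ( +-comm; +-assoc; +-identityʳ; *-zeroʳ; *-identityʳ; *-comm; *-assoc; *-distribˡ-+
        ; *-suc; ≤-refl; <⇒≤; <⇒≱; ≤-<-trans; <-cmp; m≤m+n; m∸n≤m; m+n∸m≡n; m+[n∸m]≡n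
        ; m<n⇒0<n∸m; m^n≢0 )
open import Data.Nat.Divisibility
  using ( _∣_; _∤_; divides; ∣-trans; _∣0; 1∣_; m∣m*n; ∣m⇒∣m*n; ∣m+n∣m⇒∣n
        ; *-monoʳ-∣; *-monoˡ-∣; *-cancelˡ-∣; ∣⇒≤; ∣1⇒≡1 )
open import Data.Nat.DivMod using (_/_; m*n/n≡m)
open import Data.Nat.Primality using (euclidsLemma; prime[2])
import Data.Nat.Tactic.RingSolver as ℕ-Solver
open import Data.Integer as ℤ using (+_; ∣_∣)
open import Data.Integer.Properties
  using (abs-*; pos-*; +◃n≡+n; [+m]-[+n]≡m⊖n; ∣⊖∣-≤; ∣i-j∣≡∣j-i∣)
open import Data.Integer.DivMod using (a≡a%ℕn+[a/ℕn]*n; n%ℕd<d)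
import Data.Integer.Divisibility.Signed as Signed
open Signed using (∣ᵤ⇒∣; ∣⇒∣ᵤ)
open import Data.Integer.Tactic.RingSolver using (solve-∀)
import Data.Sign.Properties as Sign
open import Data.Product using (∃; _,_)
open import Data.Sum using (inj₁; inj₂; [_,_]′)
open import Data.Empty using (⊥-elim)
open import Function using (_∘_; id; case_of_)
open import Relation.Nullary using (contradiction)
open import Relation.Binary.Definitions using (tri<; tri≈; tri>)
open import Relation.Binary.PropositionalEquality
  using (_≡_; refl; sym; trans; cong; cong₂; subst; module ≡-Reasoning)

2∣4 : 2 ∣ 4
2∣4 = divides 2 refl

4∣2^[2+n] : ∀ n → 4 ∣ 2 ^ (2 + n)
4∣2^[2+n] n = subst (4 ∣_) (*-assoc 2 2 (2 ^ n)) (m∣m*n (2 ^ n))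

odd-* : ∀ {m n} → 2 ∤ m → 2 ∤ n → 2 ∤ m * n
odd-* {m} {n} 2∤m 2∤n 2∣m*n = [ 2∤m , 2∤n ]′ (euclidsLemma m n prime[2] 2∣m*n)

odd-^ : ∀ {m} n → 2 ∤ m → 2 ∤ m ^ n
odd-^ zero    2∤m 2∣1 = contradiction (∣1⇒≡1 2∣1) λ ()
odd-^ (suc n) 2∤m     = odd-* 2∤m (odd-^ n 2∤m)

even⇒suc-odd : ∀ {n} → 2 ∣ n → 2 ∤ suc n
even⇒suc-odd {n} 2∣n 2∣1+n =
  contradiction (∣1⇒≡1 (∣m+n∣m⇒∣n (subst (2 ∣_) (+-comm 1 n) 2∣1+n) 2∣n)) λ ()

exact-power : ∀ {m} n → 2 ^ n ∣ m → 2 ^ suc n ∤ m → ∃ λ o → 2 ∤ o × m ≡ 2 ^ n * o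
exact-power n (divides o m≡o*2^n) 2^[1+n]∤m =
  o , (λ 2∣o → 2^[1+n]∤m (subst (2 ^ suc n ∣_) (sym m≡o*2^n) (*-monoˡ-∣ (2 ^ n) 2∣o))) ,
  trans m≡o*2^n (*-comm o (2 ^ n))

geom : ℕ → ℕ → ℕ
geom S zero    = 0
geom S (suc n) = 1 + S * geom S n

geom-+ : ∀ S m n → geom S (m + n) ≡ geom S m + S ^ m * geom S n
geom-+ S zero    n = sym (+-identityʳ (geom S n))
geom-+ S (suc m) n = begin
  1 + S * geom S (m + n)                       ≡⟨ cong (λ g → 1 + S * g) (geom-+ S m n) ⟩
  1 + S * (geom S m + S ^ m * g)               ≡⟨ cong suc (*-distribˡ-+ S (geom S m) _) ⟩
  1 + (S * geom S m + S * (S ^ m * g))         ≡⟨ cong (λ x → 1 + (S * geom S m + x))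
                                                       (sym (*-assoc S (S ^ m) g)) ⟩
  1 + S * geom S m + S * S ^ m * g             ∎
  where
  open ≡-Reasoning
  g = geom S n

geom-*2 : ∀ S n → geom S (n * 2) ≡ (1 + S ^ n) * geom S n
geom-*2 S n = begin
  geom S (n * 2)               ≡⟨ cong (geom S) (trans (*-suc n 1) (cong (λ x → n + x) (*-identityʳ n))) ⟩
  geom S (n + n)               ≡⟨ geom-+ S n n ⟩
  geom S n + S ^ n * geom S n  ∎
  where open ≡-Reasoning

^≡1+*geom : ∀ P n → suc P ^ n ≡ 1 + P * geom (suc P) n
^≡1+*geom P zero    = cong suc (sym (*-zeroʳ P))
^≡1+*geom P (suc n) = begin
  suc P * suc P ^ n                     ≡⟨ cong (suc P *_) (^≡1+*geom P n) ⟩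
  suc P * (1 + P * geom (suc P) n)      ≡⟨ identity P (geom (suc P) n) ⟩
  1 + P * (1 + suc P * geom (suc P) n)  ∎
  where
  open ≡-Reasoning
  identity : ∀ P g → suc P * (1 + P * g) ≡ 1 + P * (1 + suc P * g)
  identity = ℕ-Solver.solve-∀

geom≡n+P* : ∀ P n → ∃ λ h → geom (suc P) n ≡ n + P * h
geom≡n+P* P zero    = 0 , sym (*-zeroʳ P)
geom≡n+P* P (suc n) with geom≡n+P* P n
... | h , geom≡ = n + h + P * h , (begin
  1 + suc P * geom (suc P) n   ≡⟨ cong (λ g → 1 + suc P * g) geom≡ ⟩
  1 + suc P * (n + P * h)      ≡⟨ identity P n h ⟩
  suc n + P * (n + h + P * h)  ∎)
  where
  open ≡-Reasoning
  identity : ∀ P n h → 1 + suc P * (n + P * h) ≡ suc n + P * (n + h + P * h)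
  identity = ℕ-Solver.solve-∀

module _ (P : ℕ) (4∣P : 4 ∣ P) where

  open _∣_ 4∣P renaming (quotient to q; equality to P≡q*4)

  private
    S = suc P

    2∣P : 2 ∣ P
    2∣P = ∣-trans 2∣4 4∣P

  odd*geom-even⇒even : ∀ {o} n → 2 ∤ o → 2 ∣ o * geom S n → 2 ∣ n
  odd*geom-even⇒even {o} n 2∤o 2∣o*geom with geom≡n+P* P n
  ... | h , geom≡ =
    ∣m+n∣m⇒∣n (subst (2 ∣_) (trans geom≡ (+-comm n (P * h))) 2∣geom) (∣m⇒∣m*n h 2∣P)
    where
    2∣geom : 2 ∣ geom S n
    2∣geom = [ ⊥-elim ∘ 2∤o , id ]′ (euclidsLemma o (geom S n) prime[2] 2∣o*geom)

  *geom-double : ∀ o n → o * geom S (n * 2) ≡ 2 * (o * suc (2 * (q * geom S n)) * geom S n)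
  *geom-double o n = begin
    o * geom S (n * 2)               ≡⟨ cong (o *_) (geom-*2 S n) ⟩
    o * ((1 + S ^ n) * g)            ≡⟨ cong (λ s → o * ((1 + s) * g)) (^≡1+*geom P n) ⟩
    o * ((2 + P * g) * g)            ≡⟨ cong (λ p → o * ((2 + p * g) * g)) P≡q*4 ⟩
    o * ((2 + q * 4 * g) * g)        ≡⟨ identity o q g ⟩
    2 * (o * suc (2 * (q * g)) * g)  ∎
    where
    open ≡-Reasoning
    g = geom S n
    identity : ∀ o q g → o * ((2 + q * 4 * g) * g) ≡ 2 * (o * suc (2 * (q * g)) * g)
    identity = ℕ-Solver.solve-∀

  2^k∣odd*geom⇒2^k∣n : ∀ k {o} n → 2 ∤ o → 2 ^ k ∣ o * geom S n → 2 ^ k ∣ n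
  2^k∣odd*geom⇒2^k∣n zero    n 2∤o _ = 1∣ n
  2^k∣odd*geom⇒2^k∣n (suc k) {o} n 2∤o 2^[1+k]∣
    with odd*geom-even⇒even n 2∤o (∣-trans (m∣m*n (2 ^ k)) 2^[1+k]∣)
  ... | divides m refl = subst (2 ^ suc k ∣_) (*-comm 2 m) (*-monoʳ-∣ 2 2^k∣m)
    where
    2^k∣m : 2 ^ k ∣ m
    2^k∣m = 2^k∣odd*geom⇒2^k∣n k m (odd-* 2∤o (even⇒suc-odd (m∣m*n (q * geom S m))))
              (*-cancelˡ-∣ 2 (subst (2 ^ suc k ∣_) (*geom-double o m) 2^[1+k]∣))

  2^k∤odd*geom : ∀ k {o n} → 2 ∤ o → 0 < n → n < 2 ^ k → 2 ^ k ∤ o * geom S n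
  2^k∤odd*geom k {n = n} 2∤o 0<n n<2^k 2^k∣ =
    <⇒≱ n<2^k (∣⇒≤ {{>-nonZero 0<n}} (2^k∣odd*geom⇒2^k∣n k n 2∤o 2^k∣))

i*i≡+∣i∣*∣i∣ : ∀ i → i ℤ.* i ≡ + (∣ i ∣ * ∣ i ∣)
i*i≡+∣i∣*∣i∣ i = trans (cong (ℤ._◃ (∣ i ∣ * ∣ i ∣)) (Sign.s*s≡+ (ℤ.sign i))) (+◃n≡+n _)

odd⇒≡±1[mod4] : ∀ t → Odd t → t ≡ 1ℤ [mod 4 ] ⊎ t ≡ -1ℤ [mod 4 ]
odd⇒≡±1[mod4] t odd = by-residue (t ℤ.%ℕ 4) (n%ℕd<d t 4) (a≡a%ℕn+[a/ℕn]*n t 4)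
  where
  q = t ℤ./ℕ 4
  by-residue : ∀ r → r < 4 → t ≡ + r ℤ.+ q ℤ.* + 4 → t ≡ 1ℤ [mod 4 ] ⊎ t ≡ -1ℤ [mod 4 ]
  by-residue 0 _ t≡ = contradiction (∣⇒∣ᵤ (Signed.divides (q ℤ.* + 2) (trans t≡ (identity q)))) odd
    where
    identity : ∀ q → + 0 ℤ.+ q ℤ.* + 4 ≡ q ℤ.* + 2 ℤ.* + 2
    identity = solve-∀
  by-residue 1 _ t≡ = inj₁ (∣⇒∣ᵤ (Signed.divides q (trans (cong (ℤ._- 1ℤ) t≡) (identity q))))
    where
    identity : ∀ q → + 1 ℤ.+ q ℤ.* + 4 ℤ.- 1ℤ ≡ q ℤ.* + 4
    identity = solve-∀
  by-residue 2 _ t≡ =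
    contradiction (∣⇒∣ᵤ (Signed.divides (1ℤ ℤ.+ q ℤ.* + 2) (trans t≡ (identity q)))) odd
    where
    identity : ∀ q → + 2 ℤ.+ q ℤ.* + 4 ≡ (1ℤ ℤ.+ q ℤ.* + 2) ℤ.* + 2
    identity = solve-∀
  by-residue 3 _ t≡ = inj₂ (∣⇒∣ᵤ (Signed.divides (q ℤ.+ 1ℤ) (trans (cong (ℤ._- -1ℤ) t≡) (identity q))))
    where
    identity : ∀ q → + 3 ℤ.+ q ℤ.* + 4 ℤ.- -1ℤ ≡ (q ℤ.+ 1ℤ) ℤ.* + 4
    identity = solve-∀
  by-residue (suc (suc (suc (suc _)))) (s≤s (s≤s (s≤s (s≤s ())))) _

∣t+ε∣≡2*odd : ∀ t ε → ∣ ε ∣ ≡ 1 → t ≡ ε [mod 4 ] → ∃ λ w → 2 ∤ w × ∣ t ℤ.+ ε ∣ ≡ 2 ^ 1 * w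
∣t+ε∣≡2*odd t ε ∣ε∣≡1 t≡ε = exact-power 1 2∣t+ε 4∤t+ε
  where
  4∣t-ε : + 4 Signed.∣ t ℤ.- ε
  4∣t-ε = ∣ᵤ⇒∣ t≡ε

  2∣t+ε : 2 ^ 1 ∣ ∣ t ℤ.+ ε ∣
  2∣t+ε = ∣⇒∣ᵤ (subst (+ 2 Signed.∣_) (identity t ε)
            (Signed.∣m∣n⇒∣m+n (Signed.∣-trans (∣ᵤ⇒∣ 2∣4) 4∣t-ε) (Signed.∣m⇒∣m*n ε Signed.∣-refl)))
    where
    identity : ∀ t ε → t ℤ.- ε ℤ.+ + 2 ℤ.* ε ≡ t ℤ.+ ε
    identity = solve-∀

  4∤t+ε : 4 ∤ ∣ t ℤ.+ ε ∣
  4∤t+ε 4∣t+ε with ∣⇒≤ (subst (4 ∣_) ∣2ε∣≡2 (∣⇒∣ᵤ 4∣2ε))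
    where
    identity : ∀ t ε → t ℤ.+ ε ℤ.- (t ℤ.- ε) ≡ + 2 ℤ.* ε
    identity = solve-∀
    4∣2ε : + 4 Signed.∣ + 2 ℤ.* ε
    4∣2ε = subst (+ 4 Signed.∣_) (identity t ε) (Signed.∣m∣n⇒∣m-n (∣ᵤ⇒∣ {i = t ℤ.+ ε} 4∣t+ε) 4∣t-ε)
    ∣2ε∣≡2 : ∣ + 2 ℤ.* ε ∣ ≡ 2
    ∣2ε∣≡2 = trans (abs-* (+ 2) ε) (cong (2 *_) ∣ε∣≡1)
  ... | s≤s (s≤s ())

∣t²-1∣≡∣t-ε∣*∣t+ε∣ : ∀ t ε → ∣ ε ∣ ≡ 1 → ∣ t ℤ.* t ℤ.- 1ℤ ∣ ≡ ∣ t ℤ.- ε ∣ * ∣ t ℤ.+ ε ∣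
∣t²-1∣≡∣t-ε∣*∣t+ε∣ t ε ∣ε∣≡1 = begin
  ∣ t ℤ.* t ℤ.- 1ℤ ∣           ≡⟨ cong (λ x → ∣ t ℤ.* t ℤ.- x ∣) (sym ε²≡1) ⟩
  ∣ t ℤ.* t ℤ.- ε ℤ.* ε ∣      ≡⟨ cong ∣_∣ (difference-of-squares t ε) ⟩
  ∣ (t ℤ.- ε) ℤ.* (t ℤ.+ ε) ∣  ≡⟨ abs-* (t ℤ.- ε) (t ℤ.+ ε) ⟩
  ∣ t ℤ.- ε ∣ * ∣ t ℤ.+ ε ∣    ∎
  where
  open ≡-Reasoning
  ε²≡1 : ε ℤ.* ε ≡ 1ℤ
  ε²≡1 = trans (i*i≡+∣i∣*∣i∣ ε) (cong (λ n → + (n * n)) ∣ε∣≡1)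
  difference-of-squares : ∀ t ε → t ℤ.* t ℤ.- ε ℤ.* ε ≡ (t ℤ.- ε) ℤ.* (t ℤ.+ ε)
  difference-of-squares = solve-∀

∣t²-1∣≡2^[3+c]*odd : ∀ t ε c → ∣ ε ∣ ≡ 1 →
                      t ≡ ε [mod 2 ^ (2 + c) ] → ¬ t ≡ ε [mod 2 ^ (3 + c) ] →
                      ∃ λ v → 2 ∤ v × ∣ t ℤ.* t ℤ.- 1ℤ ∣ ≡ 2 ^ (3 + c) * v
∣t²-1∣≡2^[3+c]*odd t ε c ∣ε∣≡1 t≡ε t≢ε =
  combine (exact-power (2 + c) t≡ε t≢ε) (∣t+ε∣≡2*odd t ε ∣ε∣≡1 (∣-trans (4∣2^[2+n] c) t≡ε))
  where
  combine : (∃ λ f → 2 ∤ f × ∣ t ℤ.- ε ∣ ≡ 2 ^ (2 + c) * f) →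
            (∃ λ w → 2 ∤ w × ∣ t ℤ.+ ε ∣ ≡ 2 ^ 1 * w) →
            ∃ λ v → 2 ∤ v × ∣ t ℤ.* t ℤ.- 1ℤ ∣ ≡ 2 ^ (3 + c) * v
  combine (f , 2∤f , ∣t-ε∣≡) (w , 2∤w , ∣t+ε∣≡) = f * w , odd-* 2∤f 2∤w , (begin
    ∣ t ℤ.* t ℤ.- 1ℤ ∣             ≡⟨ ∣t²-1∣≡∣t-ε∣*∣t+ε∣ t ε ∣ε∣≡1 ⟩
    ∣ t ℤ.- ε ∣ * ∣ t ℤ.+ ε ∣      ≡⟨ cong₂ _*_ ∣t-ε∣≡ ∣t+ε∣≡ ⟩
    2 ^ (2 + c) * f * (2 ^ 1 * w)  ≡⟨ identity (2 ^ (2 + c)) f w ⟩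
    2 ^ (3 + c) * (f * w)          ∎)
    where
    open ≡-Reasoning
    identity : ∀ x f w → x * f * (2 * 1 * w) ≡ 2 * x * (f * w)
    identity = ℕ-Solver.solve-∀

odd-square≡1+∣square-1∣ : ∀ t → Odd t → t ℤ.* t ≡ + suc ∣ t ℤ.* t ℤ.- 1ℤ ∣
odd-square≡1+∣square-1∣ t odd =
  subst (λ s → s ≡ + suc ∣ s ℤ.- 1ℤ ∣) (sym (i*i≡+∣i∣*∣i∣ t)) (square ∣ t ∣ {{≢-nonZero ∣t∣≢0}})
  where
  ∣t∣≢0 : ∣ t ∣ ≢ 0
  ∣t∣≢0 ∣t∣≡0 = odd (subst (2 ∣_) (sym ∣t∣≡0) (2 ∣0))
  square : ∀ n → .{{NonZero n}} → + (n * n) ≡ + suc ∣ + (n * n) ℤ.- 1ℤ ∣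
  square (suc n) = refl

square≡1+2^b*odd : ∀ t → Odd t → ∀ b → 1 ≤ b →
                   ¬ (t ≡ 1ℤ [mod 2 ^ b ]) × ¬ (t ≡ -1ℤ [mod 2 ^ b ]) →
                   (∀ c → 1 ≤ c → c < b → (t ≡ 1ℤ [mod 2 ^ c ]) ⊎ (t ≡ -1ℤ [mod 2 ^ c ])) →
                   ∃ λ v → 2 ∤ v × 4 ∣ 2 ^ b × t ℤ.* t ≡ + suc (2 ^ b * v)
square≡1+2^b*odd t odd 1 _ (t≢1 , t≢-1) _ =
  ⊥-elim ([ t≢1 ∘ ∣-trans 2∣4 , t≢-1 ∘ ∣-trans 2∣4 ]′ (odd⇒≡±1[mod4] t odd))
square≡1+2^b*odd t odd 2 _ (t≢1 , t≢-1) _ = ⊥-elim ([ t≢1 , t≢-1 ]′ (odd⇒≡±1[mod4] t odd))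
square≡1+2^b*odd t odd (suc (suc (suc c))) _ (t≢1 , t≢-1) below =
  [ (λ t≡1  → square (∣t²-1∣≡2^[3+c]*odd t 1ℤ c refl t≡1 t≢1))
  , (λ t≡-1 → square (∣t²-1∣≡2^[3+c]*odd t -1ℤ c refl t≡-1 t≢-1))
  ]′ (below (2 + c) (s≤s z≤n) ≤-refl)
  where
  square : (∃ λ v → 2 ∤ v × ∣ t ℤ.* t ℤ.- 1ℤ ∣ ≡ 2 ^ (3 + c) * v) →
           ∃ λ v → 2 ∤ v × 4 ∣ 2 ^ (3 + c) × t ℤ.* t ≡ + suc (2 ^ (3 + c) * v)
  square (v , 2∤v , ∣t²-1∣≡) = v , 2∤v , 4∣2^[2+n] (suc c) ,
    trans (odd-square≡1+∣square-1∣ t odd) (cong (λ n → + suc n) ∣t²-1∣≡)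

+-^ : ∀ m n → (+ m) ℤ.^ n ≡ + (m ^ n)
+-^ m zero    = refl
+-^ m (suc n) = trans (cong (+ m ℤ.*_) (+-^ m n)) (sym (pos-* m (m ^ n)))

+[2^b*n]/2^b≡+n : ∀ b n → (+ (2 ^ b * n)) /2^ b ≡ + n
+[2^b*n]/2^b≡+n b n = cong +_ (trans (cong (λ m → _/_ m (2 ^ b) {{m^n≢0 2 b}}) (*-comm (2 ^ b) n))
                                     (m*n/n≡m n (2 ^ b) {{m^n≢0 2 b}}))

∣+m-+[m+n]∣≡n : ∀ m n → ∣ + m ℤ.- + (m + n) ∣ ≡ n
∣+m-+[m+n]∣≡n m n =
  trans (cong ∣_∣ ([+m]-[+n]≡m⊖n m (m + n))) (trans (∣⊖∣-≤ (m≤m+n m n)) (m+n∸m≡n m n))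

module _ (t : ℤ) (b : ℕ) {v : ℕ} (t²≡ : t ℤ.* t ≡ + suc (2 ^ b * v)) where

  private
    S = suc (2 ^ b * v)

  seqT≡v*geom : ∀ n → seqT t b n ≡ + (v * geom S n)
  seqT≡v*geom n = begin
    seqT t b n                          ≡⟨ cong (λ s → (s ℤ.^ n ℤ.- 1ℤ) /2^ b) t²≡ ⟩
    ((+ S) ℤ.^ n ℤ.- 1ℤ) /2^ b          ≡⟨ cong (λ s → (s ℤ.- 1ℤ) /2^ b)
                                               (trans (+-^ S n) (cong +_ (^≡1+*geom _ n))) ⟩
    (+ (2 ^ b * v * geom S n)) /2^ b    ≡⟨ cong (λ m → (+ m) /2^ b) (*-assoc (2 ^ b) v (geom S n)) ⟩
    (+ (2 ^ b * (v * geom S n))) /2^ b  ≡⟨ +[2^b*n]/2^b≡+n b (v * geom S n) ⟩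
    + (v * geom S n)                    ∎
    where open ≡-Reasoning

  ∣seqT-seqT∣≡ : ∀ p d → ∣ seqT t b p ℤ.- seqT t b (p + d) ∣ ≡ v * S ^ p * geom S d
  ∣seqT-seqT∣≡ p d = begin
    ∣ seqT t b p ℤ.- seqT t b (p + d) ∣  ≡⟨ cong₂ (λ x y → ∣ x ℤ.- y ∣) (seqT≡v*geom p) (seqT≡v*geom (p + d)) ⟩
    ∣ + a ℤ.- + (v * geom S (p + d)) ∣   ≡⟨ cong (λ x → ∣ + a ℤ.- + x ∣) split ⟩
    ∣ + a ℤ.- + (a + v * S ^ p * g) ∣    ≡⟨ ∣+m-+[m+n]∣≡n a (v * S ^ p * g) ⟩
    v * S ^ p * g                        ∎
    where
    open ≡-Reasoning
    a = v * geom S p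
    g = geom S d
    split : v * geom S (p + d) ≡ a + v * S ^ p * g
    split = trans (cong (v *_) (geom-+ S p d))
                  (trans (*-distribˡ-+ v (geom S p) _) (cong (λ x → a + x) (sym (*-assoc v (S ^ p) g))))

  seqT-apart : 2 ∤ v → 4 ∣ 2 ^ b →
               ∀ k p d → 0 < d → d < 2 ^ k → ¬ seqT t b p ≡ seqT t b (p + d) [mod 2 ^ k ]
  seqT-apart 2∤v 4∣2^b k p d 0<d d<2^k 2^k∣ =
    2^k∤odd*geom (2 ^ b * v) 4∣P k (odd-* 2∤v (odd-^ p (even⇒suc-odd (∣-trans 2∣4 4∣P)))) 0<d d<2^k
      (subst (2 ^ k ∣_) (∣seqT-seqT∣≡ p d) 2^k∣)
    where
    4∣P : 4 ∣ 2 ^ b * v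
    4∣P = ∣m⇒∣m*n v 4∣2^b

≡[mod]-sym : ∀ {a c m} → a ≡ c [mod m ] → c ≡ a [mod m ]
≡[mod]-sym {a} {c} {m} = subst (m ∣_) (∣i-j∣≡∣j-i∣ a c)

window-distinct : ∀ {m} (s : ℕ → ℤ) → (∀ p d → 0 < d → d < m → ¬ s p ≡ s (p + d) [mod m ]) →
                  ∀ i {j l} → j < m → l < m → j ≢ l → ¬ s (i + j) ≡ s (i + l) [mod m ]
window-distinct {m} s apart i {j} {l} j<m l<m j≢l = case <-cmp j l of λ where
    (tri< j<l _ _) → ordered j<l l<m
    (tri≈ _ j≡l _) → contradiction j≡l j≢l
    (tri> _ _ l<j) → ordered l<j j<m ∘ ≡[mod]-sym {s (i + j)} {s (i + l)}
  where
  ordered : ∀ {j l} → j < l → l < m → ¬ s (i + j) ≡ s (i + l) [mod m ]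
  ordered {j} {l} j<l l<m = subst (λ x → ¬ s (i + j) ≡ s x [mod m ])
    (trans (+-assoc i j (l ∸ j)) (cong (λ x → i + x) (m+[n∸m]≡n (<⇒≤ j<l))))
    (apart (i + j) (l ∸ j) (m<n⇒0<n∸m j<l) (≤-<-trans (m∸n≤m l j) l<m))

lemma4 : (t : ℤ) → Odd t → (b : ℕ) → 1 ≤ b →
         (¬ (t ≡ 1ℤ [mod 2 ^ b ]) × ¬ (t ≡ -1ℤ [mod 2 ^ b ])) →
         (∀ c → 1 ≤ c → c < b → (t ≡ 1ℤ [mod 2 ^ c ]) ⊎ (t ≡ -1ℤ [mod 2 ^ c ])) →
         ∀ (k i j l : ℕ) → j < 2 ^ k → l < 2 ^ k → j ≢ l →
         ¬ (seqT t b (i + j) ≡ seqT t b (i + l) [mod 2 ^ k ])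
lemma4 t odd b 1≤b t≢±1 minimal k i j l j<2^k l<2^k j≢l =
  let (v , 2∤v , 4∣2^b , t²≡) = square≡1+2^b*odd t odd b 1≤b t≢±1 minimal
  in  window-distinct (seqT t b) (seqT-apart t b t²≡ 2∤v 4∣2^b k) i j<2^k l<2^k j≢l
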